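{- Let $(\varphi_j)_{j\ge0}$ be non-negative numbers with $\varphi_0>0$ and $\varphi(t)=\sum_j\varphi_jt^j$. For $m\ge1$ let $T_m$ be the total weight of free multilabelled increasing trees with label set $\{1,\dots,m\}$, i.e. $T_m=\sum w(T)$, the sum ranging over all pairs consisting of an ordered tree $T$ and a free increasing multilabelling of $T$ with label set $\{1,\dots,m\}$, where $w(T)=\prod_{v\in T}\varphi_{\mathrm{outdeg}(v)}$. Let $T(z)=\sum_{m\ge1}T_m\frac{z^m}{m!}$. Then \[T'(z)=\varphi(T(z))+T(z),\qquad T(0)=0.\]
   Context: Ordered trees are rooted trees in which the children of each node form a linearly ordered sequence; $\mathrm{outdeg}(v)$ is the number of children of $v$. A free increasing multilabelling of a tree $T$ with label set $\{1,\dots,m\}$ (where $m\ge|T|$) assigns to each node $v$ a non-empty set $\ell(v)$ of labels such that the sets $\ell(v)$, $v\in T$, form a partition of $\{1,\dots,m\}$, and whenever $w$ is a child of $v$, every label of $w$ is larger than every label of $v$.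
   Formalization: The numbers $\varphi_j$ are taken to be non-negative rationals. -}

module Defs where

open import Data.Nat as ℕ using (ℕ; zero; suc; _!)
open import Data.Nat.Properties using (_!≢0)
open import Data.Bool using (Bool; true; false)
open import Data.Fin as Fin using (Fin)
open import Data.Fin.Subset using (Subset; _∈_; Nonempty)
open import Data.Vec using (lookup)
open import Data.List using (List; []; _∷_; length; filter; _++_; upTo; map)
open import Data.List.Relation.Unary.All using (All)
open import Data.List.Relation.Unary.Unique.Propositional using (Unique)
import Data.List.Membership.Propositional as LMem
open import Data.Product using (Σ; _×_)
open import Data.Integer using (+_)
open import Data.Rational using (ℚ; 0ℚ; 1ℚ; _+_; _*_; _/_)
open import Relation.Binary.PropositionalEquality using (_≡_)
open import Function.Bundles using (_⇔_)
import Data.Bool.Properties as BoolP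

-- Ordered trees carrying a label set (a subset of {1..m}, encoded as
-- Fin m) at every node.  A value of type LTree m is exactly a pair
-- (ordered tree T, assignment ℓ of a subset of labels to each node).

data LTree (m : ℕ) : Set where
  node : Subset m → List (LTree m) → LTree m

root : ∀ {m} → LTree m → Subset m
root (node s _) = s

mutual
  labelsOf : ∀ {m} → LTree m → List (Subset m)
  labelsOf (node s cs) = s ∷ labelsOfList cs

  labelsOfList : ∀ {m} → List (LTree m) → List (Subset m)
  labelsOfList []       = []
  labelsOfList (c ∷ cs) = labelsOf c ++ labelsOfList cs

IsPartition : ∀ {m} → LTree m → Set
IsPartition {m} t =
  All Nonempty (labelsOf t) ×
  ((i : Fin m) → length (filter (λ s → lookup s i BoolP.≟ true) (labelsOf t)) ≡ 1)

data Increasing {m : ℕ} : LTree m → Set where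
  inc : ∀ {s cs} →
        All (λ c → ∀ i j → i ∈ s → j ∈ root c → i Fin.< j) cs →
        All Increasing cs →
        Increasing (node s cs)

IsFreeIncMultilabelled : ∀ {m} → LTree m → Set
IsFreeIncMultilabelled t = IsPartition t × Increasing t

mutual
  weight : (ℕ → ℚ) → ∀ {m} → LTree m → ℚ
  weight φ (node s cs) = φ (length cs) * weightList φ cs

  weightList : (ℕ → ℚ) → ∀ {m} → List (LTree m) → ℚ
  weightList φ []       = 1ℚ
  weightList φ (c ∷ cs) = weight φ c * weightList φ cs

sumℚ : List ℚ → ℚ
sumℚ []       = 0ℚ
sumℚ (x ∷ xs) = x + sumℚ xs

Enumeration : ℕ → Set
Enumeration m = Σ (List (LTree m)) λ L →
  Unique L × ((t : LTree m) → (LMem._∈_ t L) ⇔ IsFreeIncMultilabelled t)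

totalWeight : (ℕ → ℚ) → ∀ {m} → Enumeration m → ℚ
totalWeight φ (L Data.Product., _) = sumℚ (map (weight φ) L)

PowerSeries : Set
PowerSeries = ℕ → ℚ

egf : (ℕ → ℚ) → PowerSeries
egf T zero    = 0ℚ
egf T (suc m) = T (suc m) * ((+ 1) / (suc m) ! )
  where instance _ = (suc m) !≢0

deriv : PowerSeries → PowerSeries
deriv f n = ((+ suc n) / 1) * f (suc n)

one : PowerSeries
one zero    = 1ℚ
one (suc n) = 0ℚ

_⊛_ : PowerSeries → PowerSeries → PowerSeries
(f ⊛ g) n = sumℚ (map (λ k → f k * g (n ℕ.∸ k)) (upTo (suc n)))

_^ps_ : PowerSeries → ℕ → PowerSeries
f ^ps zero  = one
f ^ps suc j = f ⊛ (f ^ps j)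

-- composition φ(f) = Σ_j φ_j f^j, for f with zero constant term:
-- the coefficient of z^n only receives contributions from j ≤ n.
compose : (ℕ → ℚ) → PowerSeries → PowerSeries
compose φ f n = sumℚ (map (λ j → φ j * (f ^ps j) n) (upTo (suc n)))

_⊕_ : PowerSeries → PowerSeries → PowerSeries
(f ⊕ g) n = f n + g n

{-# OPTIONS --safe #-}
module Submission where

-- Let 0 be the least label. In a tree multilabelled by {0} ∪ S the label 0 lies in the root, since
-- every label below the root exceeds every label of the root. Either the root carries further labels,
-- and deleting 0 leaves a tree on S (the term T), or the root is exactly {0}, and its k subtrees form
-- an ordered forest on S (the term φ_k T^k). A forest on S is a split S = L ⊎ R with a tree on L and a
-- forest on R, so forest weights are iterated binomial convolutions of tree weights, which are the
-- coefficients of the powers of the exponential generating function. Hence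
-- T_{n+1} = T_n + Σ_k φ_k n! [z^n] T(z)^k, which is T' = φ(T) + T coefficientwise. The sums are taken
-- over explicit duplicate-free enumerations; any two of them are permutations of each other, so T_m
-- does not depend on the enumeration.

open import Defs
open import Data.Nat using (ℕ)
open import Data.Rational using (ℚ; 0ℚ; _≤_; _<_)
open import Data.Product using (_×_)
open import Relation.Binary.PropositionalEquality using (_≡_)

open import Data.Bool using (if_then_else_)
import Data.Bool.Properties as Bool
open import Data.Empty using (⊥-elim)
open import Data.Fin as Fin using (Fin; zero; suc)
open import Data.Fin.Subset using (Subset; Side; inside; outside; _∈_; _∉_; ∣_∣; Nonempty; ⊥; ⊤)
import Data.Fin.Subset.Properties as Subset
import Data.Integer as ℤ
import Data.Integer.Properties as ℤ
open import Data.List as List using (List; []; _∷_; _++_; map; concatMap; upTo)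
import Data.List.Properties as List
open import Data.List.Membership.Propositional using (find) renaming (_∈_ to _∈ₗ_)
open import Data.List.Membership.Propositional.Properties
  using (∈-upTo⁺; ∈-upTo⁻; ∈-map⁺; ∈-map⁻; ∈-++⁺ˡ; ∈-++⁺ʳ; ∈-++⁻; ∈-concatMap⁺; ∈-concatMap⁻;
         ∈-cartesianProductWith⁺; ∈-cartesianProductWith⁻)
open import Data.List.Membership.Propositional.Properties.WithK using (unique∧set⇒bag)
open import Data.List.Relation.Binary.BagAndSetEquality using (∼bag⇒↭)
open import Data.List.Relation.Binary.Permutation.Propositional using (_↭_; ↭⇒↭ₛ)
import Data.List.Relation.Binary.Permutation.Propositional.Properties as ↭
open import Data.List.Relation.Binary.Permutation.Setoid.Properties using (foldr-commMonoid)
open import Data.List.Relation.Unary.All as All using (All; []; _∷_)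
import Data.List.Relation.Unary.All.Properties as All
open import Data.List.Relation.Unary.AllPairs using ([]; _∷_)
open import Data.List.Relation.Unary.Any as Any using (here; there)
open import Data.List.Relation.Unary.Unique.Propositional using (Unique)
import Data.List.Relation.Unary.Unique.Propositional.Properties as Unique
open import Data.Nat as ℕ using (zero; suc; _∸_; _!)
open import Data.Nat.Combinatorics using (_C_; nCk+nC[k+1]≡[n+1]C[k+1]; k>n⇒nCk≡0; nCk≡n!/k![n-k]!; k![n∸k]!∣n!)
open import Data.Nat.DivMod using (m/n*n≡m)
open import Data.Nat.Induction using (<-rec)
import Data.Nat.Properties as ℕ
open import Data.Product using (∃-syntax; ∃₂; _,_; proj₁; proj₂)
open import Data.Rational using (1ℚ; _+_; _*_; _/_; toℚᵘ)
import Data.Rational.Properties as ℚ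
open import Data.Rational.Solver using (module +-*-Solver)
import Data.Rational.Unnormalised as ℚᵘ
import Data.Rational.Unnormalised.Properties as ℚᵘ
open import Data.Sum as Sum using (inj₁; inj₂)
open import Data.Vec as Vec using ([]; _∷_; here; there; lookup)
import Data.Vec.Properties as Vec
open import Function using (_∘_; id)
open import Function.Bundles using (_⇔_; mk⇔; Equivalence)
open import Function.Properties.Equivalence using () renaming (trans to ⇔-trans; sym to ⇔-sym)
open import Relation.Binary.PropositionalEquality using (refl; sym; trans; cong; cong₂; module ≡-Reasoning)
import Relation.Binary.PropositionalEquality as ≡
open import Relation.Nullary using (¬_; yes; no; does)
open import Relation.Unary using (_∪_)

private
  variable
    X Y Z : Set

fromℕ : ℕ → ℚ
fromℕ n = ℤ.+ n / 1

infix 8 1/_!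

1/_! : ℕ → ℚ
1/ n ! = (ℤ.+ 1 / n !) {{n ℕ.!≢0}}

private
  toℚᵘ-/ : ∀ a b .{{_ : ℕ.NonZero b}} → toℚᵘ (ℤ.+ a / b) ℚᵘ.≃ ℚᵘ.mkℚᵘ (ℤ.+ a) (ℕ.pred b)
  toℚᵘ-/ a (suc b) = ℚ.toℚᵘ-fromℚᵘ (ℚᵘ.mkℚᵘ (ℤ.+ a) b)

/-≡-cross : ∀ a b c d .{{_ : ℕ.NonZero b}} .{{_ : ℕ.NonZero d}} →
            a ℕ.* d ≡ c ℕ.* b → ℤ.+ a / b ≡ ℤ.+ c / d
/-≡-cross a b@(suc _) c d@(suc _) eq =
  ℚ.fromℚᵘ-cong {ℚᵘ.mkℚᵘ (ℤ.+ a) (ℕ.pred b)} {ℚᵘ.mkℚᵘ (ℤ.+ c) (ℕ.pred d)} (ℚᵘ.*≡* (begin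
    (ℤ.+ a) ℤ.* (ℤ.+ d)  ≡⟨ ℤ.pos-* a d ⟨
    ℤ.+ (a ℕ.* d)        ≡⟨ cong ℤ.+_ eq ⟩
    ℤ.+ (c ℕ.* b)        ≡⟨ ℤ.pos-* c b ⟩
    (ℤ.+ c) ℤ.* (ℤ.+ b)  ∎))
  where open ≡-Reasoning

/-*-/ : ∀ a b c d .{{_ : ℕ.NonZero b}} .{{_ : ℕ.NonZero d}} →
        (ℤ.+ a / b) * (ℤ.+ c / d) ≡ (ℤ.+ (a ℕ.* c) / (b ℕ.* d)) {{ℕ.m*n≢0 b d}}
/-*-/ a b@(suc _) c d@(suc _) = ℚ.toℚᵘ-injective (begin
  toℚᵘ ((ℤ.+ a / b) * (ℤ.+ c / d))                ≈⟨ ℚ.toℚᵘ-homo-* (ℤ.+ a / b) (ℤ.+ c / d) ⟩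
  toℚᵘ (ℤ.+ a / b) ℚᵘ.* toℚᵘ (ℤ.+ c / d)          ≈⟨ ℚᵘ.*-cong (toℚᵘ-/ a b) (toℚᵘ-/ c d) ⟩
  ℚᵘ.mkℚᵘ ((ℤ.+ a) ℤ.* (ℤ.+ c)) (ℕ.pred (b ℕ.* d)) ≡⟨ cong (λ n → ℚᵘ.mkℚᵘ n _) (ℤ.pos-* a c) ⟨
  ℚᵘ.mkℚᵘ (ℤ.+ (a ℕ.* c)) (ℕ.pred (b ℕ.* d))       ≈⟨ toℚᵘ-/ (a ℕ.* c) (b ℕ.* d) ⟨
  toℚᵘ (ℤ.+ (a ℕ.* c) / (b ℕ.* d))                 ∎)
  where open ℚᵘ.≃-Reasoning

/-+-/ : ∀ a b c d .{{_ : ℕ.NonZero b}} .{{_ : ℕ.NonZero d}} →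
        (ℤ.+ a / b) + (ℤ.+ c / d) ≡ (ℤ.+ (a ℕ.* d ℕ.+ c ℕ.* b) / (b ℕ.* d)) {{ℕ.m*n≢0 b d}}
/-+-/ a b@(suc _) c d@(suc _) = ℚ.toℚᵘ-injective (begin
  toℚᵘ ((ℤ.+ a / b) + (ℤ.+ c / d))
    ≈⟨ ℚ.toℚᵘ-homo-+ (ℤ.+ a / b) (ℤ.+ c / d) ⟩
  toℚᵘ (ℤ.+ a / b) ℚᵘ.+ toℚᵘ (ℤ.+ c / d)
    ≈⟨ ℚᵘ.+-cong (toℚᵘ-/ a b) (toℚᵘ-/ c d) ⟩
  ℚᵘ.mkℚᵘ ((ℤ.+ a) ℤ.* (ℤ.+ d) ℤ.+ (ℤ.+ c) ℤ.* (ℤ.+ b)) (ℕ.pred (b ℕ.* d))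
    ≡⟨ cong (λ n → ℚᵘ.mkℚᵘ n _) numerator ⟨
  ℚᵘ.mkℚᵘ (ℤ.+ (a ℕ.* d ℕ.+ c ℕ.* b)) (ℕ.pred (b ℕ.* d))
    ≈⟨ toℚᵘ-/ (a ℕ.* d ℕ.+ c ℕ.* b) (b ℕ.* d) ⟨
  toℚᵘ (ℤ.+ (a ℕ.* d ℕ.+ c ℕ.* b) / (b ℕ.* d)) ∎)
  where
  open ℚᵘ.≃-Reasoning
  numerator : ℤ.+ (a ℕ.* d ℕ.+ c ℕ.* b) ≡ (ℤ.+ a) ℤ.* (ℤ.+ d) ℤ.+ (ℤ.+ c) ℤ.* (ℤ.+ b)
  numerator = trans (ℤ.pos-+ (a ℕ.* d) (c ℕ.* b)) (cong₂ ℤ._+_ (ℤ.pos-* a d) (ℤ.pos-* c b))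

fromℕ-homo-+ : ∀ m n → fromℕ (m ℕ.+ n) ≡ fromℕ m + fromℕ n
fromℕ-homo-+ m n = sym (trans (/-+-/ m 1 n 1) (/-≡-cross (m ℕ.* 1 ℕ.+ n ℕ.* 1) 1 (m ℕ.+ n) 1
  (cong (ℕ._* 1) (cong₂ ℕ._+_ (ℕ.*-identityʳ m) (ℕ.*-identityʳ n)))))

fromℕ*1/ : ∀ a b .{{_ : ℕ.NonZero b}} → fromℕ a * (ℤ.+ 1 / b) ≡ ℤ.+ a / b
fromℕ*1/ a b = trans (/-*-/ a 1 1 b) (/-≡-cross (a ℕ.* 1) (1 ℕ.* b) a b {{ℕ.m*n≢0 1 b}}
  (cong₂ ℕ._*_ (ℕ.*-identityʳ a) (sym (ℕ.*-identityˡ b))))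

[1+n]*1/[1+n]!≡1/n! : ∀ n → fromℕ (suc n) * 1/ suc n ! ≡ 1/ n !
[1+n]*1/[1+n]!≡1/n! n = trans (fromℕ*1/ (suc n) (suc n !) {{suc n ℕ.!≢0}})
  (/-≡-cross (suc n) (suc n !) 1 (n !) {{suc n ℕ.!≢0}} {{n ℕ.!≢0}} (sym (ℕ.*-identityˡ (suc n !))))

nCk*1/n!≡1/k!*1/[n∸k]! : ∀ {n k} → k ℕ.≤ n → fromℕ (n C k) * 1/ n ! ≡ 1/ k ! * 1/ (n ∸ k) !
nCk*1/n!≡1/k!*1/[n∸k]! {n} {k} k≤n = begin
  fromℕ (n C k) * 1/ n !
    ≡⟨ fromℕ*1/ (n C k) (n !) {{n ℕ.!≢0}} ⟩
  (ℤ.+ (n C k) / n !) {{n ℕ.!≢0}}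
    ≡⟨ /-≡-cross (n C k) (n !) 1 (k ! ℕ.* (n ∸ k) !) {{n ℕ.!≢0}} {{k!*[n∸k]!≢0}} cross ⟩
  (ℤ.+ 1 / (k ! ℕ.* (n ∸ k) !)) {{k!*[n∸k]!≢0}}
    ≡⟨ /-*-/ 1 (k !) 1 ((n ∸ k) !) {{k ℕ.!≢0}} {{(n ∸ k) ℕ.!≢0}} ⟨
  1/ k ! * 1/ (n ∸ k) ! ∎
  where
  open ≡-Reasoning
  k!*[n∸k]!≢0 : ℕ.NonZero (k ! ℕ.* (n ∸ k) !)
  k!*[n∸k]!≢0 = ℕ._!*_!≢0 k (n ∸ k)
  cross : (n C k) ℕ.* (k ! ℕ.* (n ∸ k) !) ≡ 1 ℕ.* n !
  cross = trans (cong (ℕ._* (k ! ℕ.* (n ∸ k) !)) (nCk≡n!/k![n-k]! k≤n))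
                (trans (m/n*n≡m {{k!*[n∸k]!≢0}} (k![n∸k]!∣n! k≤n)) (sym (ℕ.*-identityˡ (n !))))

-- Finite sums and exponential generating functions

sumℚ-++ : ∀ (xs ys : List ℚ) → sumℚ (xs ++ ys) ≡ sumℚ xs + sumℚ ys
sumℚ-++ []       ys = sym (ℚ.+-identityˡ (sumℚ ys))
sumℚ-++ (x ∷ xs) ys = trans (cong (x +_) (sumℚ-++ xs ys)) (sym (ℚ.+-assoc x (sumℚ xs) (sumℚ ys)))

sumℚ-map-++ : ∀ (w : X → ℚ) xs ys → sumℚ (map w (xs ++ ys)) ≡ sumℚ (map w xs) + sumℚ (map w ys)
sumℚ-map-++ w xs ys = trans (cong sumℚ (List.map-++ w xs ys)) (sumℚ-++ (map w xs) (map w ys))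

sumℚ-map-concatMap : ∀ (w : Y → ℚ) (f : X → List Y) xs →
                     sumℚ (map w (concatMap f xs)) ≡ sumℚ (map (λ x → sumℚ (map w (f x))) xs)
sumℚ-map-concatMap w f []       = refl
sumℚ-map-concatMap w f (x ∷ xs) =
  trans (sumℚ-map-++ w (f x) (concatMap f xs)) (cong (sumℚ (map w (f x)) +_) (sumℚ-map-concatMap w f xs))

sumℚ-map-∘ : ∀ (w : Y → ℚ) (f : X → Y) xs → sumℚ (map w (map f xs)) ≡ sumℚ (map (w ∘ f) xs)
sumℚ-map-∘ w f xs = cong sumℚ (sym (List.map-∘ xs))

sumℚ-map-cong-∈ : ∀ {f g : X → ℚ} xs → (∀ {x} → x ∈ₗ xs → f x ≡ g x) →
                  sumℚ (map f xs) ≡ sumℚ (map g xs)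
sumℚ-map-cong-∈ xs f≗g = cong sumℚ (List.map-cong-local (All.tabulate f≗g))

sumℚ-map-cong : ∀ {f g : X → ℚ} xs → (∀ x → f x ≡ g x) → sumℚ (map f xs) ≡ sumℚ (map g xs)
sumℚ-map-cong xs f≗g = cong sumℚ (List.map-cong f≗g xs)

sumℚ-map-+ : ∀ (f g : X → ℚ) xs → sumℚ (map (λ x → f x + g x) xs) ≡ sumℚ (map f xs) + sumℚ (map g xs)
sumℚ-map-+ f g []       = sym (ℚ.+-identityˡ 0ℚ)
sumℚ-map-+ f g (x ∷ xs) = trans (cong (f x + g x +_) (sumℚ-map-+ f g xs)) (+-interchange (f x) (g x) _ _)
  where
  open +-*-Solver
  +-interchange : ∀ a b c d → (a + b) + (c + d) ≡ (a + c) + (b + d)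
  +-interchange = solve 4 (λ a b c d → (a :+ b) :+ (c :+ d) := (a :+ c) :+ (b :+ d)) refl

*-distribˡ-sumℚ : ∀ a (f : X → ℚ) xs → a * sumℚ (map f xs) ≡ sumℚ (map (λ x → a * f x) xs)
*-distribˡ-sumℚ a f []       = ℚ.*-zeroʳ a
*-distribˡ-sumℚ a f (x ∷ xs) = trans (ℚ.*-distribˡ-+ a (f x) _) (cong (a * f x +_) (*-distribˡ-sumℚ a f xs))

*-distribʳ-sumℚ : ∀ a (f : X → ℚ) xs → sumℚ (map f xs) * a ≡ sumℚ (map (λ x → f x * a) xs)
*-distribʳ-sumℚ a f []       = ℚ.*-zeroˡ a
*-distribʳ-sumℚ a f (x ∷ xs) = trans (ℚ.*-distribʳ-+ a (f x) _) (cong (f x * a +_) (*-distribʳ-sumℚ a f xs))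

sumℚ-map-cartesianProductWith : ∀ {w : Z → ℚ} {u : X → ℚ} {v : Y → ℚ} (f : X → Y → Z) →
                                (∀ x y → w (f x y) ≡ u x * v y) → ∀ xs ys →
                                sumℚ (map w (List.cartesianProductWith f xs ys)) ≡ sumℚ (map u xs) * sumℚ (map v ys)
sumℚ-map-cartesianProductWith {v = v} f w≡uv []       ys = sym (ℚ.*-zeroˡ (sumℚ (map v ys)))
sumℚ-map-cartesianProductWith {w = w} {u} {v} f w≡uv (x ∷ xs) ys = begin
  sumℚ (map w (map (f x) ys ++ List.cartesianProductWith f xs ys))
    ≡⟨ sumℚ-map-++ w (map (f x) ys) _ ⟩
  sumℚ (map w (map (f x) ys)) + sumℚ (map w (List.cartesianProductWith f xs ys))
    ≡⟨ cong₂ _+_ (trans (sumℚ-map-∘ w (f x) ys) (sumℚ-map-cong ys (w≡uv x)))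
                 (sumℚ-map-cartesianProductWith f w≡uv xs ys) ⟩
  sumℚ (map (λ y → u x * v y) ys) + sumℚ (map u xs) * sumℚ (map v ys)
    ≡⟨ cong (_+ sumℚ (map u xs) * sumℚ (map v ys)) (*-distribˡ-sumℚ (u x) v ys) ⟨
  u x * sumℚ (map v ys) + sumℚ (map u xs) * sumℚ (map v ys)
    ≡⟨ ℚ.*-distribʳ-+ (sumℚ (map v ys)) (u x) (sumℚ (map u xs)) ⟨
  sumℚ (map u (x ∷ xs)) * sumℚ (map v ys) ∎
  where open ≡-Reasoning

sumℚ-↭ : ∀ {xs ys : List ℚ} → xs ↭ ys → sumℚ xs ≡ sumℚ ys
sumℚ-↭ {xs} {ys} xs↭ys = begin
  sumℚ xs               ≡⟨ sumℚ≗foldr xs ⟩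
  List.foldr _+_ 0ℚ xs  ≡⟨ foldr-commMonoid (≡.setoid ℚ) ℚ.+-0-isCommutativeMonoid (↭⇒↭ₛ xs↭ys) ⟩
  List.foldr _+_ 0ℚ ys  ≡⟨ sumℚ≗foldr ys ⟨
  sumℚ ys               ∎
  where
  open ≡-Reasoning
  sumℚ≗foldr : ∀ zs → sumℚ zs ≡ List.foldr _+_ 0ℚ zs
  sumℚ≗foldr []       = refl
  sumℚ≗foldr (z ∷ zs) = cong (z +_) (sumℚ≗foldr zs)

sumUpTo : ℕ → (ℕ → ℚ) → ℚ
sumUpTo n f = sumℚ (map f (upTo n))

infix 5 sumUpTo
syntax sumUpTo n (λ i → e) = ∑[ i < n ] e

sumUpTo-cong : ∀ n {f g : ℕ → ℚ} → (∀ {i} → i ℕ.< n → f i ≡ g i) → sumUpTo n f ≡ sumUpTo n g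
sumUpTo-cong n f≗g = sumℚ-map-cong-∈ (upTo n) (f≗g ∘ ∈-upTo⁻)

sumUpTo-suc : ∀ n (f : ℕ → ℚ) → sumUpTo (suc n) f ≡ f 0 + sumUpTo n (f ∘ suc)
sumUpTo-suc n f = cong (λ xs → f 0 + sumℚ xs)
  (trans (List.map-applyUpTo suc f n) (sym (List.map-applyUpTo id (f ∘ suc) n)))

sumUpTo-last : ∀ n (f : ℕ → ℚ) → sumUpTo (suc n) f ≡ sumUpTo n f + f n
sumUpTo-last n f = begin
  sumℚ (map f (upTo (suc n)))         ≡⟨ cong (sumℚ ∘ map f) (List.upTo-∷ʳ n) ⟨
  sumℚ (map f (upTo n List.∷ʳ n))     ≡⟨ sumℚ-map-++ f (upTo n) List.[ n ] ⟩
  sumUpTo n f + (f n + 0ℚ)                 ≡⟨ cong (sumUpTo n f +_) (ℚ.+-identityʳ (f n)) ⟩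
  sumUpTo n f + f n                        ∎
  where open ≡-Reasoning

binomialConvolution : (ℕ → ℚ) → (ℕ → ℚ) → ℕ → ℚ
binomialConvolution F G n = ∑[ i < suc n ] fromℕ (n C i) * F i * G (n ∸ i)

binomialConvolution-suc : ∀ F G n → binomialConvolution F G (suc n) ≡
                          binomialConvolution F (G ∘ suc) n + binomialConvolution (F ∘ suc) G n
binomialConvolution-suc F G n = begin
  binomialConvolution F G (suc n)
    ≡⟨ sumUpTo-suc (suc n) (λ i → fromℕ (suc n C i) * F i * G (suc n ∸ i)) ⟩
  x₀ + (∑[ i < suc n ] fromℕ (suc n C suc i) * F (suc i) * G (n ∸ i))
    ≡⟨ cong (x₀ +_) (trans (sumUpTo-cong (suc n) (λ {i} _ → pascal i)) (sumℚ-map-+ a b (upTo (suc n)))) ⟩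
  x₀ + (sumUpTo (suc n) a + sumUpTo (suc n) b)
    ≡⟨ cong (λ s → x₀ + (sumUpTo (suc n) a + s)) sum-b≡sum-b′ ⟩
  x₀ + (sumUpTo (suc n) a + sumUpTo n b′)
    ≡⟨ +-rearrange x₀ (sumUpTo (suc n) a) (sumUpTo n b′) ⟩
  (x₀ + sumUpTo n b′) + sumUpTo (suc n) a
    ≡⟨ cong (_+ sumUpTo (suc n) a) (sumUpTo-suc n (λ i → fromℕ (n C i) * F i * G (suc (n ∸ i)))) ⟨
  binomialConvolution F (G ∘ suc) n + binomialConvolution (F ∘ suc) G n ∎
  where
  open ≡-Reasoning
  open +-*-Solver
  x₀ : ℚ
  x₀ = fromℕ 1 * F 0 * G (suc n)
  a b b′ : ℕ → ℚ
  a i  = fromℕ (n C i) * F (suc i) * G (n ∸ i)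
  b i  = fromℕ (n C suc i) * F (suc i) * G (n ∸ i)
  b′ i = fromℕ (n C suc i) * F (suc i) * G (suc (n ∸ suc i))

  pascal : ∀ i → fromℕ (suc n C suc i) * F (suc i) * G (n ∸ i) ≡ a i + b i
  pascal i = begin
    fromℕ (suc n C suc i) * F (suc i) * G (n ∸ i)
      ≡⟨ cong (λ c → fromℕ c * F (suc i) * G (n ∸ i)) (nCk+nC[k+1]≡[n+1]C[k+1] n i) ⟨
    fromℕ (n C i ℕ.+ n C suc i) * F (suc i) * G (n ∸ i)
      ≡⟨ cong (λ c → c * F (suc i) * G (n ∸ i)) (fromℕ-homo-+ (n C i) (n C suc i)) ⟩
    (fromℕ (n C i) + fromℕ (n C suc i)) * F (suc i) * G (n ∸ i)
      ≡⟨ solve 4 (λ c d f g → (c :+ d) :* f :* g := c :* f :* g :+ d :* f :* g) refl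
               (fromℕ (n C i)) (fromℕ (n C suc i)) (F (suc i)) (G (n ∸ i)) ⟩
    a i + b i ∎

  sum-b≡sum-b′ : sumUpTo (suc n) b ≡ sumUpTo n b′
  sum-b≡sum-b′ = begin
    sumUpTo (suc n) b
      ≡⟨ sumUpTo-last n b ⟩
    sumUpTo n b + b n
      ≡⟨ cong (λ c → sumUpTo n b + fromℕ c * F (suc n) * G (n ∸ n)) (k>n⇒nCk≡0 (ℕ.n<1+n n)) ⟩
    sumUpTo n b + 0ℚ * F (suc n) * G (n ∸ n)
      ≡⟨ cong (sumUpTo n b +_) (solve 2 (λ f g → con 0ℚ :* f :* g := con 0ℚ) refl (F (suc n)) (G (n ∸ n))) ⟩
    sumUpTo n b + 0ℚ
      ≡⟨ ℚ.+-identityʳ (sumUpTo n b) ⟩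
    sumUpTo n b
      ≡⟨ sumUpTo-cong n (λ {i} i<n → cong (λ j → fromℕ (n C suc i) * F (suc i) * G j) (ℕ.+-∸-assoc 1 i<n)) ⟩
    sumUpTo n b′ ∎

  +-rearrange : ∀ x a b → x + (a + b) ≡ (x + b) + a
  +-rearrange = solve 3 (λ x a b → x :+ (a :+ b) := (x :+ b) :+ a) refl

IsEGF : (ℕ → ℚ) → PowerSeries → Set
IsEGF F f = ∀ n → f n ≡ F n * 1/ n !

⊛-isEGF : ∀ {F G f g} → IsEGF F f → IsEGF G g → IsEGF (binomialConvolution F G) (f ⊛ g)
⊛-isEGF {F} {G} {f} {g} f≐F g≐G n = begin
  ∑[ k < suc n ] f k * g (n ∸ k)
    ≡⟨ sumUpTo-cong (suc n) (λ k<1+n → term (ℕ.≤-pred k<1+n)) ⟩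
  ∑[ k < suc n ] fromℕ (n C k) * F k * G (n ∸ k) * 1/ n !
    ≡⟨ *-distribʳ-sumℚ (1/ n !) (λ k → fromℕ (n C k) * F k * G (n ∸ k)) (upTo (suc n)) ⟨
  binomialConvolution F G n * 1/ n ! ∎
  where
  open ≡-Reasoning
  open +-*-Solver
  term : ∀ {k} → k ℕ.≤ n → f k * g (n ∸ k) ≡ fromℕ (n C k) * F k * G (n ∸ k) * 1/ n !
  term {k} k≤n = begin
    f k * g (n ∸ k)
      ≡⟨ cong₂ _*_ (f≐F k) (g≐G (n ∸ k)) ⟩
    (F k * 1/ k !) * (G (n ∸ k) * 1/ (n ∸ k) !)
      ≡⟨ solve 4 (λ a b x y → (a :* x) :* (b :* y) := (a :* b) :* (x :* y)) refl
                 (F k) (G (n ∸ k)) (1/ k !) (1/ (n ∸ k) !) ⟩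
    (F k * G (n ∸ k)) * (1/ k ! * 1/ (n ∸ k) !)
      ≡⟨ cong (F k * G (n ∸ k) *_) (nCk*1/n!≡1/k!*1/[n∸k]! k≤n) ⟨
    (F k * G (n ∸ k)) * (fromℕ (n C k) * 1/ n !)
      ≡⟨ solve 4 (λ a b c z → (a :* b) :* (c :* z) := c :* a :* b :* z) refl
                 (F k) (G (n ∸ k)) (fromℕ (n C k)) (1/ n !) ⟩
    fromℕ (n C k) * F k * G (n ∸ k) * 1/ n ! ∎

-- Enumerations

Enumerates : (X → Set) → List X → Set
Enumerates {X} P xs = Unique xs × ((x : X) → x ∈ₗ xs ⇔ P x)

Image : (X → Y) → (X → Set) → Y → Set
Image f P y = ∃[ x ] P x × f x ≡ y

enumerates-⇔ : ∀ {P Q : X → Set} → (∀ x → P x ⇔ Q x) → ∀ {xs} → Enumerates P xs → Enumerates Q xs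
enumerates-⇔ P⇔Q (u , ∈⇔P) = u , λ x → ⇔-trans (∈⇔P x) (P⇔Q x)

enumerates-[] : ∀ {P : X → Set} → (∀ x → ¬ P x) → Enumerates P []
enumerates-[] ¬P = [] , λ x → mk⇔ (λ ()) (⊥-elim ∘ ¬P x)

enumerates-[-] : ∀ (x : X) → Enumerates (_≡ x) List.[ x ]
enumerates-[-] x = [] ∷ [] , λ y → mk⇔ (λ { (here y≡x) → y≡x ; (there ()) }) here

enumerates-map : ∀ {P : X → Set} {xs} (f : X → Y) → (∀ {x x′} → f x ≡ f x′ → x ≡ x′) →
                 Enumerates P xs → Enumerates (Image f P) (map f xs)
enumerates-map {P = P} {xs} f f-injective (u , ∈⇔P) = Unique.map⁺ f-injective u , λ y → mk⇔ (to y) from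
  where
  to : ∀ y → y ∈ₗ map f xs → Image f P y
  to y y∈ with x , x∈xs , refl ← ∈-map⁻ f y∈ = x , Equivalence.to (∈⇔P x) x∈xs , refl
  from : ∀ {y} → Image f P y → y ∈ₗ map f xs
  from (x , Px , refl) = ∈-map⁺ f (Equivalence.from (∈⇔P x) Px)

enumerates-++ : ∀ {P Q : X → Set} {xs ys} → (∀ {x} → P x → ¬ Q x) →
                Enumerates P xs → Enumerates Q ys → Enumerates (P ∪ Q) (xs ++ ys)
enumerates-++ {P = P} {Q} {xs} {ys} P∩Q≡∅ (uxs , ∈⇔P) (uys , ∈⇔Q) =
  Unique.++⁺ uxs uys disjoint , λ x → mk⇔ (to x) (from x)
  where
  disjoint : ∀ {x} → ¬ (x ∈ₗ xs × x ∈ₗ ys)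
  disjoint {x} (x∈xs , x∈ys) = P∩Q≡∅ (Equivalence.to (∈⇔P x) x∈xs) (Equivalence.to (∈⇔Q x) x∈ys)
  to : ∀ x → x ∈ₗ xs ++ ys → (P ∪ Q) x
  to x x∈ with ∈-++⁻ xs x∈
  ... | inj₁ x∈xs = inj₁ (Equivalence.to (∈⇔P x) x∈xs)
  ... | inj₂ x∈ys = inj₂ (Equivalence.to (∈⇔Q x) x∈ys)
  from : ∀ x → (P ∪ Q) x → x ∈ₗ xs ++ ys
  from x (inj₁ Px) = ∈-++⁺ˡ (Equivalence.from (∈⇔P x) Px)
  from x (inj₂ Qx) = ∈-++⁺ʳ xs (Equivalence.from (∈⇔Q x) Qx)

enumerates-concatMap : ∀ {P : X → Set} {Q : X → Y → Set} {xs} {f : X → List Y} →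
                       (∀ {x x′ y} → Q x y → Q x′ y → x ≡ x′) →
                       Enumerates P xs → (∀ x → Enumerates (Q x) (f x)) →
                       Enumerates (λ y → ∃[ x ] P x × Q x y) (concatMap f xs)
enumerates-concatMap {P = P} {Q} {xs} {f} Q-functional (uxs , ∈⇔P) enum-f =
  unique-concatMap uxs , λ y → mk⇔ (to y) from
  where
  ∈f⇔Q : ∀ x {y} → y ∈ₗ f x ⇔ Q x y
  ∈f⇔Q x {y} = proj₂ (enum-f x) y
  unique-concatMap : ∀ {xs} → Unique xs → Unique (concatMap f xs)
  unique-concatMap {[]}     []           = []
  unique-concatMap {x ∷ xs} (x∉xs ∷ uxs) = Unique.++⁺ (proj₁ (enum-f x)) (unique-concatMap uxs) disjoint
    where
    disjoint : ∀ {y} → ¬ (y ∈ₗ f x × y ∈ₗ concatMap f xs)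
    disjoint (y∈fx , y∈rest) with x′ , x′∈xs , y∈fx′ ← find (∈-concatMap⁻ f y∈rest) =
      All.lookup x∉xs x′∈xs
        (Q-functional (Equivalence.to (∈f⇔Q x) y∈fx) (Equivalence.to (∈f⇔Q x′) y∈fx′))
  to : ∀ y → y ∈ₗ concatMap f xs → ∃[ x ] P x × Q x y
  to y y∈ with x , x∈xs , y∈fx ← find (∈-concatMap⁻ f y∈) =
    x , Equivalence.to (∈⇔P x) x∈xs , Equivalence.to (∈f⇔Q x) y∈fx
  from : ∀ {y} → ∃[ x ] P x × Q x y → y ∈ₗ concatMap f xs
  from (x , Px , Qxy) =
    ∈-concatMap⁺ f (Any.map (λ { refl → Equivalence.from (∈f⇔Q x) Qxy }) (Equivalence.from (∈⇔P x) Px))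

enumerates-cartesianProductWith :
  ∀ {P : X → Set} {Q : Y → Set} {xs ys} (f : X → Y → Z) →
  (∀ {x x′ y y′} → f x y ≡ f x′ y′ → x ≡ x′ × y ≡ y′) →
  Enumerates P xs → Enumerates Q ys →
  Enumerates (λ z → ∃₂ λ x y → P x × Q y × f x y ≡ z) (List.cartesianProductWith f xs ys)
enumerates-cartesianProductWith {P = P} {Q} {xs} {ys} f f-injective (uxs , ∈⇔P) (uys , ∈⇔Q) =
  Unique.cartesianProductWith⁺ f f-injective uxs uys , λ z → mk⇔ (to z) from
  where
  to : ∀ z → z ∈ₗ List.cartesianProductWith f xs ys → ∃₂ λ x y → P x × Q y × f x y ≡ z
  to z z∈ with x , y , x∈xs , y∈ys , refl ← ∈-cartesianProductWith⁻ f xs ys z∈ =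
    x , y , Equivalence.to (∈⇔P x) x∈xs , Equivalence.to (∈⇔Q y) y∈ys , refl
  from : ∀ {z} → ∃₂ (λ x y → P x × Q y × f x y ≡ z) → z ∈ₗ List.cartesianProductWith f xs ys
  from (x , y , Px , Qy , refl) =
    ∈-cartesianProductWith⁺ f (Equivalence.from (∈⇔P x) Px) (Equivalence.from (∈⇔Q y) Qy)

enumerates⇒↭ : ∀ {P : X → Set} {xs ys} → Enumerates P xs → Enumerates P ys → xs ↭ ys
enumerates⇒↭ (uxs , ∈xs⇔P) (uys , ∈ys⇔P) =
  ∼bag⇒↭ (unique∧set⇒bag uxs uys (λ {x} → ⇔-trans (∈xs⇔P x) (⇔-sym (∈ys⇔P x))))

sumℚ-map-enumerates : ∀ {P : X → Set} {xs ys} (w : X → ℚ) → Enumerates P xs → Enumerates P ys →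
                      sumℚ (map w xs) ≡ sumℚ (map w ys)
sumℚ-map-enumerates w exs eys = sumℚ-↭ (↭.map⁺ w (enumerates⇒↭ exs eys))

indicator : Side → ℕ
indicator outside = 0
indicator inside  = 1

IsSplit : ∀ {m} → Subset m → Subset m × Subset m → Set
IsSplit S (L , R) = ∀ i → indicator (lookup L i) ℕ.+ indicator (lookup R i) ≡ indicator (lookup S i)

cons₂ : ∀ {m} → Side → Side → Subset m × Subset m → Subset (suc m) × Subset (suc m)
cons₂ l r (L , R) = l ∷ L , r ∷ R

splits : ∀ {m} → Subset m → List (Subset m × Subset m)
splits []            = List.[ [] , [] ]
splits (outside ∷ S) = map (cons₂ outside outside) (splits S)
splits (inside ∷ S)  = map (cons₂ outside inside) (splits S) ++ map (cons₂ inside outside) (splits S)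

private
  cons₂-injective : ∀ {m} {l r} {p q : Subset m × Subset m} → cons₂ l r p ≡ cons₂ l r q → p ≡ q
  cons₂-injective {p = _ , _} {_ , _} refl = refl

  isSplit-outside⇔ : ∀ {m} {S : Subset m} p →
                     Image (cons₂ outside outside) (IsSplit S) p ⇔ IsSplit (outside ∷ S) p
  isSplit-outside⇔ {S = S} p = mk⇔ to (from p)
    where
    to : ∀ {p} → Image (cons₂ outside outside) (IsSplit S) p → IsSplit (outside ∷ S) p
    to (_ , split , refl) = λ { zero → refl ; (suc i) → split i }
    from : ∀ p → IsSplit (outside ∷ S) p → Image (cons₂ outside outside) (IsSplit S) p
    from (outside ∷ L , outside ∷ R) split = (L , R) , split ∘ suc , refl
    from (outside ∷ L , inside ∷ R)  split with () ← split zero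
    from (inside ∷ L , r ∷ R)        split with () ← split zero

  isSplit-inside⇔ : ∀ {m} {S : Subset m} p →
                    (Image (cons₂ outside inside) (IsSplit S) ∪ Image (cons₂ inside outside) (IsSplit S)) p ⇔
                    IsSplit (inside ∷ S) p
  isSplit-inside⇔ {S = S} p = mk⇔ to (from p)
    where
    to : ∀ {p} → (Image (cons₂ outside inside) (IsSplit S) ∪ Image (cons₂ inside outside) (IsSplit S)) p →
         IsSplit (inside ∷ S) p
    to (inj₁ (_ , split , refl)) = λ { zero → refl ; (suc i) → split i }
    to (inj₂ (_ , split , refl)) = λ { zero → refl ; (suc i) → split i }
    from : ∀ p → IsSplit (inside ∷ S) p →
           (Image (cons₂ outside inside) (IsSplit S) ∪ Image (cons₂ inside outside) (IsSplit S)) p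
    from (outside ∷ L , inside ∷ R)  split = inj₁ ((L , R) , split ∘ suc , refl)
    from (inside ∷ L , outside ∷ R)  split = inj₂ ((L , R) , split ∘ suc , refl)
    from (outside ∷ L , outside ∷ R) split with () ← split zero
    from (inside ∷ L , inside ∷ R)   split with () ← split zero

splits-enumerates : ∀ {m} (S : Subset m) → Enumerates (IsSplit S) (splits S)
splits-enumerates [] = enumerates-⇔ (λ { ([] , []) → mk⇔ (λ _ ()) (λ _ → refl) }) (enumerates-[-] ([] , []))
splits-enumerates (outside ∷ S) =
  enumerates-⇔ isSplit-outside⇔ (enumerates-map (cons₂ outside outside) cons₂-injective (splits-enumerates S))
splits-enumerates (inside ∷ S) = enumerates-⇔ isSplit-inside⇔ (enumerates-++ disjoint
  (enumerates-map (cons₂ outside inside) cons₂-injective (splits-enumerates S))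
  (enumerates-map (cons₂ inside outside) cons₂-injective (splits-enumerates S)))
  where
  disjoint : ∀ {p} → Image (cons₂ outside inside) (IsSplit S) p → ¬ Image (cons₂ inside outside) (IsSplit S) p
  disjoint (_ , _ , refl) (_ , _ , ())

isSplit⇒∣L∣+∣R∣≡∣S∣ : ∀ {m} {S L R : Subset m} → IsSplit S (L , R) → ∣ L ∣ ℕ.+ ∣ R ∣ ≡ ∣ S ∣
isSplit⇒∣L∣+∣R∣≡∣S∣ {S = []} {[]} {[]} _ = refl
isSplit⇒∣L∣+∣R∣≡∣S∣ {S = s ∷ S} {l ∷ L} {r ∷ R} split
  with s | l | r | split zero | isSplit⇒∣L∣+∣R∣≡∣S∣ {S = S} {L} {R} (split ∘ suc)
... | outside | outside | outside | _ | eq = eq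
... | inside  | outside | inside  | _ | eq = trans (ℕ.+-suc ∣ L ∣ ∣ R ∣) (cong suc eq)
... | inside  | inside  | outside | _ | eq = cong suc eq

sumℚ-splits : ∀ {m} (G H : ℕ → ℚ) (S : Subset m) →
              sumℚ (map (λ (L , R) → G ∣ L ∣ * H ∣ R ∣) (splits S)) ≡ binomialConvolution G H ∣ S ∣
sumℚ-splits G H [] = cong (_+ 0ℚ) (cong (_* H 0) (sym (ℚ.*-identityˡ (G 0))))
sumℚ-splits G H (outside ∷ S) = trans (sumℚ-map-∘ _ (cons₂ outside outside) (splits S)) (sumℚ-splits G H S)
sumℚ-splits G H (inside ∷ S) = begin
  sumℚ (map w (map (cons₂ outside inside) (splits S) ++ map (cons₂ inside outside) (splits S)))
    ≡⟨ sumℚ-map-++ w (map (cons₂ outside inside) (splits S)) (map (cons₂ inside outside) (splits S)) ⟩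
  sumℚ (map w (map (cons₂ outside inside) (splits S))) + sumℚ (map w (map (cons₂ inside outside) (splits S)))
    ≡⟨ cong₂ _+_ (trans (sumℚ-map-∘ w (cons₂ outside inside) (splits S)) (sumℚ-splits G (H ∘ suc) S))
                 (trans (sumℚ-map-∘ w (cons₂ inside outside) (splits S)) (sumℚ-splits (G ∘ suc) H S)) ⟩
  binomialConvolution G (H ∘ suc) ∣ S ∣ + binomialConvolution (G ∘ suc) H ∣ S ∣
    ≡⟨ binomialConvolution-suc G H ∣ S ∣ ⟨
  binomialConvolution G H (suc ∣ S ∣) ∎
  where
  open ≡-Reasoning
  w : Subset (suc _) × Subset (suc _) → ℚ
  w (L , R) = G ∣ L ∣ * H ∣ R ∣

nonempty⇒0<∣p∣ : ∀ {m} {p : Subset m} → Nonempty p → 0 ℕ.< ∣ p ∣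
nonempty⇒0<∣p∣ {p = inside ∷ p}  _                  = ℕ.s≤s ℕ.z≤n
nonempty⇒0<∣p∣ {p = outside ∷ p} (suc x , there x∈p) = nonempty⇒0<∣p∣ (x , x∈p)

mutual
  mapLabels : ∀ {m n} → (Subset m → Subset n) → LTree m → LTree n
  mapLabels f (node s cs) = node (f s) (mapLabelsForest f cs)

  mapLabelsForest : ∀ {m n} → (Subset m → Subset n) → List (LTree m) → List (LTree n)
  mapLabelsForest f []       = []
  mapLabelsForest f (c ∷ cs) = mapLabels f c ∷ mapLabelsForest f cs

module _ {m n} (f : Subset m → Subset n) where

  mutual
    labelsOf-mapLabels : ∀ t → labelsOf (mapLabels f t) ≡ map f (labelsOf t)
    labelsOf-mapLabels (node s cs) = cong (f s ∷_) (labelsOfList-mapLabelsForest cs)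

    labelsOfList-mapLabelsForest : ∀ cs → labelsOfList (mapLabelsForest f cs) ≡ map f (labelsOfList cs)
    labelsOfList-mapLabelsForest []       = refl
    labelsOfList-mapLabelsForest (c ∷ cs) = trans
      (cong₂ _++_ (labelsOf-mapLabels c) (labelsOfList-mapLabelsForest cs))
      (sym (List.map-++ f (labelsOf c) (labelsOfList cs)))

  length-mapLabelsForest : ∀ cs → List.length (mapLabelsForest f cs) ≡ List.length cs
  length-mapLabelsForest []       = refl
  length-mapLabelsForest (c ∷ cs) = cong suc (length-mapLabelsForest cs)

  mutual
    weight-mapLabels : ∀ φ t → weight φ (mapLabels f t) ≡ weight φ t
    weight-mapLabels φ (node s cs) =
      cong₂ _*_ (cong φ (length-mapLabelsForest cs)) (weightList-mapLabelsForest φ cs)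

    weightList-mapLabelsForest : ∀ φ cs → weightList φ (mapLabelsForest f cs) ≡ weightList φ cs
    weightList-mapLabelsForest φ []       = refl
    weightList-mapLabelsForest φ (c ∷ cs) = cong₂ _*_ (weight-mapLabels φ c) (weightList-mapLabelsForest φ cs)

  mutual
    mapLabels-∘ : ∀ {k} (g : Subset n → Subset k) t → mapLabels g (mapLabels f t) ≡ mapLabels (g ∘ f) t
    mapLabels-∘ g (node s cs) = cong (node (g (f s))) (mapLabelsForest-∘ g cs)

    mapLabelsForest-∘ : ∀ {k} (g : Subset n → Subset k) cs →
                        mapLabelsForest g (mapLabelsForest f cs) ≡ mapLabelsForest (g ∘ f) cs
    mapLabelsForest-∘ g []       = refl
    mapLabelsForest-∘ g (c ∷ cs) = cong₂ _∷_ (mapLabels-∘ g c) (mapLabelsForest-∘ g cs)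

module _ {m} {f : Subset m → Subset m} where

  mutual
    mapLabels-identity : ∀ t → All (λ s → f s ≡ s) (labelsOf t) → mapLabels f t ≡ t
    mapLabels-identity (node s cs) (fs≡s ∷ fcs≡cs) = cong₂ node fs≡s (mapLabelsForest-identity cs fcs≡cs)

    mapLabelsForest-identity : ∀ cs → All (λ s → f s ≡ s) (labelsOfList cs) → mapLabelsForest f cs ≡ cs
    mapLabelsForest-identity []       _     = refl
    mapLabelsForest-identity (c ∷ cs) fs≡s = cong₂ _∷_
      (mapLabels-identity c (All.++⁻ˡ (labelsOf c) fs≡s))
      (mapLabelsForest-identity cs (All.++⁻ʳ (labelsOf c) fs≡s))

shiftForest : ∀ {m} → List (LTree m) → List (LTree (suc m))
shiftForest = mapLabelsForest (outside ∷_)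

addLeastLabel : ∀ {m} → Side → LTree m → LTree (suc m)
addLeastLabel b (node s cs) = node (b ∷ s) (shiftForest cs)

removeLeastLabel : ∀ {m} → LTree (suc m) → LTree m
removeLeastLabel = mapLabels Vec.tail

plant : ∀ {m} → List (LTree m) → LTree (suc m)
plant cs = addLeastLabel inside (node ⊥ cs)

removeLeastLabel-addLeastLabel : ∀ {m} b (t : LTree m) → removeLeastLabel (addLeastLabel b t) ≡ t
removeLeastLabel-addLeastLabel b (node s cs) = cong (node s)
  (trans (mapLabelsForest-∘ (outside ∷_) Vec.tail cs) (mapLabelsForest-identity cs (All.universal (λ _ → refl) _)))

addLeastLabel-injective : ∀ {m} b {t u : LTree m} → addLeastLabel b t ≡ addLeastLabel b u → t ≡ u
addLeastLabel-injective b {t} {u} eq = begin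
  t                                       ≡⟨ removeLeastLabel-addLeastLabel b t ⟨
  removeLeastLabel (addLeastLabel b t)    ≡⟨ cong removeLeastLabel eq ⟩
  removeLeastLabel (addLeastLabel b u)    ≡⟨ removeLeastLabel-addLeastLabel b u ⟩
  u                                       ∎
  where open ≡-Reasoning

children : ∀ {m} → LTree m → List (LTree m)
children (node _ cs) = cs

plant-injective : ∀ {m} {cs ds : List (LTree m)} → plant cs ≡ plant ds → cs ≡ ds
plant-injective eq = cong children (addLeastLabel-injective inside eq)

addLeastLabel-removeLeastLabel : ∀ {m} b {s} (cs : List (LTree (suc m))) → lookup s zero ≡ b →
                                 All (zero ∉_) (labelsOfList cs) →
                                 addLeastLabel b (removeLeastLabel (node s cs)) ≡ node s cs
addLeastLabel-removeLeastLabel b {b ∷ s} cs refl 0∉cs = cong (node (b ∷ s))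
  (trans (mapLabelsForest-∘ Vec.tail (outside ∷_) cs) (mapLabelsForest-identity cs (All.map outside∷tail 0∉cs)))
  where
  outside∷tail : ∀ {m} {s : Subset (suc m)} → zero ∉ s → outside ∷ Vec.tail s ≡ s
  outside∷tail {s = outside ∷ _} _   = refl
  outside∷tail {s = inside ∷ _}  0∉s = ⊥-elim (0∉s here)

weight-addLeastLabel : ∀ {m} φ b (t : LTree m) → weight φ (addLeastLabel b t) ≡ weight φ t
weight-addLeastLabel φ b (node s cs) =
  cong₂ _*_ (cong φ (length-mapLabelsForest (outside ∷_) cs)) (weightList-mapLabelsForest (outside ∷_) φ cs)

_≺_ : ∀ {m} → Subset m → Subset m → Set
s ≺ s′ = ∀ i j → i ∈ s → j ∈ s′ → i Fin.< j

∷≺outside∷⇔ : ∀ {m} b {s s′ : Subset m} → (b ∷ s) ≺ (outside ∷ s′) ⇔ s ≺ s′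
∷≺outside∷⇔ b = mk⇔ to from
  where
  to : ∀ {s s′} → (b ∷ s) ≺ (outside ∷ s′) → s ≺ s′
  to s≺s′ i j i∈s j∈s′ = ℕ.≤-pred (s≺s′ (suc i) (suc j) (there i∈s) (there j∈s′))
  from : ∀ {s s′} → s ≺ s′ → (b ∷ s) ≺ (outside ∷ s′)
  from s≺s′ zero    (suc j) here        _           = ℕ.s≤s ℕ.z≤n
  from s≺s′ (suc i) (suc j) (there i∈s) (there j∈s′) = ℕ.s≤s (s≺s′ i j i∈s j∈s′)

⊥≺ : ∀ {m} {s : Subset m} → ⊥ ≺ s
⊥≺ i j i∈⊥ _ = ⊥-elim (Subset.∉⊥ i∈⊥)

mutual
  increasing-addLeastLabel⁺ : ∀ {m} b (t : LTree m) → Increasing t → Increasing (addLeastLabel b t)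
  increasing-addLeastLabel⁺ b (node s cs) (inc s≺cs incs) =
    inc (≺-shift cs s≺cs) (increasing-shiftForest⁺ cs incs)
    where
    ≺-shift : ∀ cs → All (λ c → s ≺ root c) cs → All (λ c → (b ∷ s) ≺ root c) (shiftForest cs)
    ≺-shift []             []             = []
    ≺-shift (node _ _ ∷ cs) (s≺c ∷ s≺cs) = Equivalence.from (∷≺outside∷⇔ b) s≺c ∷ ≺-shift cs s≺cs

  increasing-shiftForest⁺ : ∀ {m} (cs : List (LTree m)) → All Increasing cs → All Increasing (shiftForest cs)
  increasing-shiftForest⁺ []              []           = []
  increasing-shiftForest⁺ (node s ds ∷ cs) (incc ∷ incs) =
    increasing-addLeastLabel⁺ outside (node s ds) incc ∷ increasing-shiftForest⁺ cs incs

mutual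
  increasing-addLeastLabel⁻ : ∀ {m} b (t : LTree m) → Increasing (addLeastLabel b t) → Increasing t
  increasing-addLeastLabel⁻ b (node s cs) (inc s≺cs incs) =
    inc (≺-unshift cs s≺cs) (increasing-shiftForest⁻ cs incs)
    where
    ≺-unshift : ∀ cs → All (λ c → (b ∷ s) ≺ root c) (shiftForest cs) → All (λ c → s ≺ root c) cs
    ≺-unshift []             []             = []
    ≺-unshift (node _ _ ∷ cs) (s≺c ∷ s≺cs) = Equivalence.to (∷≺outside∷⇔ b) s≺c ∷ ≺-unshift cs s≺cs

  increasing-shiftForest⁻ : ∀ {m} (cs : List (LTree m)) → All Increasing (shiftForest cs) → All Increasing cs
  increasing-shiftForest⁻ []              []           = []
  increasing-shiftForest⁻ (node s ds ∷ cs) (incc ∷ incs) =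
    increasing-addLeastLabel⁻ outside (node s ds) incc ∷ increasing-shiftForest⁻ cs incs

Above : ∀ {m} → Fin m → Subset m → Set
Above i s = ∀ j → j ∈ s → i Fin.< j

above-descendants : ∀ {m} {i : Fin m} cs → All (Above i ∘ root) cs → All Increasing cs →
                    All Nonempty (labelsOfList cs) → All (Above i) (labelsOfList cs)
above-descendants []               []             []                      _        = []
above-descendants {i = i} (node r ds ∷ cs) (i<r ∷ i<cs) (inc r≺ds incds ∷ inccs) nonempty
  with (j , j∈r) ∷ ne-ds ← All.++⁻ˡ (r ∷ labelsOfList ds) nonempty =
  All.++⁺ (i<r ∷ above-descendants ds (All.map (λ {d} → i<root {d}) r≺ds) incds ne-ds)
          (above-descendants cs i<cs inccs (All.++⁻ʳ (r ∷ labelsOfList ds) nonempty))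
  where
  i<root : ∀ {d} → r ≺ root d → Above i (root d)
  i<root r≺d k k∈d = ℕ.<-trans (i<r j j∈r) (r≺d j k j∈r k∈d)

increasing⇒0∉children : ∀ {m} {s : Subset (suc m)} {cs} → Nonempty s → Increasing (node s cs) →
                        All Nonempty (labelsOfList cs) → All (zero ∉_) (labelsOfList cs)
increasing⇒0∉children {cs = cs} (i , i∈s) (inc s≺cs incs) nonempty =
  All.map (λ above 0∈ → ℕ.n≮0 (above zero 0∈))
          (above-descendants cs (All.map (λ s≺c j → s≺c i j i∈s) s≺cs) incs nonempty)

occurrences : ∀ {m} → Fin m → List (Subset m) → ℕ
occurrences i ls = List.length (List.filter (λ s → lookup s i Bool.≟ inside) ls)

CoversOnce : ∀ {m} → Subset m → List (Subset m) → Set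
CoversOnce S ls = ∀ i → occurrences i ls ≡ indicator (lookup S i)

IsPartitionOf : ∀ {m} → Subset m → List (Subset m) → Set
IsPartitionOf S ls = All Nonempty ls × CoversOnce S ls

indicator-injective : ∀ {b c} → indicator b ≡ indicator c → b ≡ c
indicator-injective {outside} {outside} _ = refl
indicator-injective {inside}  {inside}  _ = refl

indicator-summands : ∀ m n b → m ℕ.+ n ≡ indicator b →
                     m ≡ indicator (0 ℕ.<ᵇ m) × n ≡ indicator (0 ℕ.<ᵇ n)
indicator-summands 0       0       _       _  = refl , refl
indicator-summands 0       1       _       _  = refl , refl
indicator-summands 1       0       _       _  = refl , refl
indicator-summands 0       (suc (suc _)) outside ()
indicator-summands 0       (suc (suc _)) inside  ()
indicator-summands 1       (suc _) outside ()
indicator-summands 1       (suc _) inside  ()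
indicator-summands (suc (suc _)) _ outside ()
indicator-summands (suc (suc _)) _ inside  ()

occurrences-∷ : ∀ {m} (i : Fin m) s ls →
                occurrences i (s ∷ ls) ≡ indicator (lookup s i) ℕ.+ occurrences i ls
occurrences-∷ i s ls with lookup s i
... | inside  = refl
... | outside = refl

occurrences-++ : ∀ {m} (i : Fin m) xs ys →
                 occurrences i (xs ++ ys) ≡ occurrences i xs ℕ.+ occurrences i ys
occurrences-++ i xs ys =
  trans (cong List.length (List.filter-++ (λ s → lookup s i Bool.≟ inside) xs ys))
        (List.length-++ (List.filter (λ s → lookup s i Bool.≟ inside) xs))

occurrences-∉ : ∀ {m} {i : Fin m} ls → All (i ∉_) ls → occurrences i ls ≡ 0
occurrences-∉         []       []           = refl
occurrences-∉ {i = i} (s ∷ ls) (i∉s ∷ i∉ls) =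
  trans (occurrences-∷ i s ls) (cong₂ ℕ._+_ (cong indicator (∉⇒outside i∉s)) (occurrences-∉ ls i∉ls))
  where
  ∉⇒outside : ∀ {s : Subset _} → i ∉ s → lookup s i ≡ outside
  ∉⇒outside {s} i∉s with lookup s i in eq
  ... | inside  = ⊥-elim (i∉s (Vec.lookup⇒[]= i s eq))
  ... | outside = refl

occurrences-suc-shift : ∀ {m} (i : Fin m) ls → occurrences (suc i) (map (outside ∷_) ls) ≡ occurrences i ls
occurrences-suc-shift i []       = refl
occurrences-suc-shift i (s ∷ ls) = begin
  occurrences (suc i) ((outside ∷ s) ∷ map (outside ∷_) ls)              ≡⟨ occurrences-∷ (suc i) (outside ∷ s) _ ⟩
  indicator (lookup s i) ℕ.+ occurrences (suc i) (map (outside ∷_) ls)   ≡⟨ cong (_ ℕ.+_) (occurrences-suc-shift i ls) ⟩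
  indicator (lookup s i) ℕ.+ occurrences i ls                            ≡⟨ occurrences-∷ i s ls ⟨
  occurrences i (s ∷ ls)                                                 ∎
  where open ≡-Reasoning

occurrences-zero-shift : ∀ {m} (ls : List (Subset m)) → occurrences zero (map (outside ∷_) ls) ≡ 0
occurrences-zero-shift []       = refl
occurrences-zero-shift (_ ∷ ls) = occurrences-zero-shift ls

coversOnce-shift⇔ : ∀ {m} b {S s : Subset m} ls →
                    CoversOnce (b ∷ S) ((b ∷ s) ∷ map (outside ∷_) ls) ⇔ CoversOnce S (s ∷ ls)
coversOnce-shift⇔ b {S} {s} ls = mk⇔
  (λ covers i → trans (sym (at-suc i)) (covers (suc i)))
  (λ { covers zero    → at-zero
     ; covers (suc i) → trans (at-suc i) (covers i) })
  where
  at-zero : occurrences zero ((b ∷ s) ∷ map (outside ∷_) ls) ≡ indicator b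
  at-zero = trans (occurrences-∷ zero (b ∷ s) _)
                  (trans (cong (indicator b ℕ.+_) (occurrences-zero-shift ls)) (ℕ.+-identityʳ _))
  at-suc : ∀ i → occurrences (suc i) ((b ∷ s) ∷ map (outside ∷_) ls) ≡ occurrences i (s ∷ ls)
  at-suc i = trans (occurrences-∷ (suc i) (b ∷ s) _)
                   (trans (cong (_ ℕ.+_) (occurrences-suc-shift i ls)) (sym (occurrences-∷ i s ls)))

coversOnce-⊥∷⇔ : ∀ {m} {S : Subset m} ls → CoversOnce S (⊥ ∷ ls) ⇔ CoversOnce S ls
coversOnce-⊥∷⇔ ls = mk⇔ (λ covers i → trans (sym (⊥∷ i)) (covers i)) (λ covers i → trans (⊥∷ i) (covers i))
  where
  ⊥∷ : ∀ i → occurrences i (⊥ ∷ ls) ≡ occurrences i ls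
  ⊥∷ i = trans (occurrences-∷ i ⊥ ls)
               (cong (λ b → indicator b ℕ.+ occurrences i ls) (Vec.lookup-replicate i outside))

coversOnce-[]⇔ : ∀ {m} {S : Subset m} → CoversOnce S [] ⇔ (¬ Nonempty S)
coversOnce-[]⇔ {S = S} = mk⇔
  (λ covers (i , i∈S) → 0≢1 (trans (covers i) (cong indicator (Vec.[]=⇒lookup i∈S))))
  (λ empty i → cong indicator (sym (trans (cong (λ S → lookup S i) (Subset.Empty-unique empty))
                                          (Vec.lookup-replicate i outside))))
  where
  0≢1 : ¬ (0 ≡ 1)
  0≢1 ()

coversOnce-functional : ∀ {m} {S S′ : Subset m} {ls} → CoversOnce S ls → CoversOnce S′ ls → S ≡ S′
coversOnce-functional {S = S} {S′} covers covers′ = begin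
  S                          ≡⟨ Vec.tabulate∘lookup S ⟨
  Vec.tabulate (lookup S)    ≡⟨ Vec.tabulate-cong (λ i → indicator-injective (trans (sym (covers i)) (covers′ i))) ⟩
  Vec.tabulate (lookup S′)   ≡⟨ Vec.tabulate∘lookup S′ ⟩
  S′                         ∎
  where open ≡-Reasoning

isPartitionOf-++⇔ : ∀ {m} {S : Subset m} xs ys → IsPartitionOf S (xs ++ ys) ⇔
                    (∃[ p ] IsSplit S p × IsPartitionOf (proj₁ p) xs × IsPartitionOf (proj₂ p) ys)
isPartitionOf-++⇔ {S = S} xs ys = mk⇔ to from
  where
  support : List (Subset _) → Subset _
  support ls = Vec.tabulate (λ i → 0 ℕ.<ᵇ occurrences i ls)
  to : IsPartitionOf S (xs ++ ys) → ∃[ p ] IsSplit S p × IsPartitionOf (proj₁ p) xs × IsPartitionOf (proj₂ p) ys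
  to (nonempty , covers) =
    (support xs , support ys) , split , (All.++⁻ˡ xs nonempty , covers-xs) , (All.++⁻ʳ xs nonempty , covers-ys)
    where
    summands : ∀ i → occurrences i xs ≡ indicator (0 ℕ.<ᵇ occurrences i xs) ×
                     occurrences i ys ≡ indicator (0 ℕ.<ᵇ occurrences i ys)
    summands i = indicator-summands (occurrences i xs) (occurrences i ys) (lookup S i)
                                    (trans (sym (occurrences-++ i xs ys)) (covers i))
    covers-xs : CoversOnce (support xs) xs
    covers-xs i = trans (proj₁ (summands i)) (cong indicator (sym (Vec.lookup∘tabulate _ i)))
    covers-ys : CoversOnce (support ys) ys
    covers-ys i = trans (proj₂ (summands i)) (cong indicator (sym (Vec.lookup∘tabulate _ i)))
    split : IsSplit S (support xs , support ys)
    split i = trans (cong₂ ℕ._+_ (sym (covers-xs i)) (sym (covers-ys i)))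
                    (trans (sym (occurrences-++ i xs ys)) (covers i))
  from : (∃[ p ] IsSplit S p × IsPartitionOf (proj₁ p) xs × IsPartitionOf (proj₂ p) ys) →
         IsPartitionOf S (xs ++ ys)
  from (_ , split , (ne-xs , covers-xs) , (ne-ys , covers-ys)) = All.++⁺ ne-xs ne-ys ,
    λ i → trans (occurrences-++ i xs ys) (trans (cong₂ ℕ._+_ (covers-xs i) (covers-ys i)) (split i))

IncMultilabelled : ∀ {m} → Subset m → LTree m → Set
IncMultilabelled S t = IsPartitionOf S (labelsOf t) × Increasing t

IncMultilabelledForest : ∀ {m} → Subset m → List (LTree m) → Set
IncMultilabelledForest S f = IsPartitionOf S (labelsOfList f) × All Increasing f

isFreeIncMultilabelled⇔ : ∀ {m} (t : LTree m) → IsFreeIncMultilabelled t ⇔ IncMultilabelled ⊤ t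
isFreeIncMultilabelled⇔ t = mk⇔
  (λ ((nonempty , once) , increasing) → (nonempty , λ i → trans (once i) (sym (indicator-⊤ i))) , increasing)
  (λ ((nonempty , covers) , increasing) → (nonempty , λ i → trans (covers i) (indicator-⊤ i)) , increasing)
  where
  indicator-⊤ : ∀ {m} (i : Fin m) → indicator (lookup ⊤ i) ≡ 1
  indicator-⊤ i = cong indicator (Vec.lookup-replicate i inside)

incMultilabelledForest-∷⇔ : ∀ {m} {S : Subset m} t f → IncMultilabelledForest S (t ∷ f) ⇔
  (∃[ p ] IsSplit S p × IncMultilabelled (proj₁ p) t × IncMultilabelledForest (proj₂ p) f)
incMultilabelledForest-∷⇔ {S = S} t f = mk⇔
  (λ { (partition , inc-t ∷ inc-f) →
         let p , split , pt , pf = Equivalence.to (isPartitionOf-++⇔ {S = S} (labelsOf t) (labelsOfList f)) partition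
         in p , split , (pt , inc-t) , (pf , inc-f) })
  (λ (p , split , (pt , inc-t) , (pf , inc-f)) →
     Equivalence.from (isPartitionOf-++⇔ {S = S} (labelsOf t) (labelsOfList f)) (p , split , pt , pf) , inc-t ∷ inc-f)

incMultilabelled⇒nonempty : ∀ {m} {S : Subset m} {t} → IncMultilabelled S t → Nonempty S
incMultilabelled⇒nonempty {S = S} {node s cs} ((((i , i∈s) ∷ _) , covers) , _) =
  i , Vec.lookup⇒[]= i S (indicator-suc (begin
    indicator (lookup S i)                                    ≡⟨ covers i ⟨
    occurrences i (s ∷ labelsOfList cs)                       ≡⟨ occurrences-∷ i s _ ⟩
    indicator (lookup s i) ℕ.+ occurrences i (labelsOfList cs) ≡⟨ cong (λ b → indicator b ℕ.+ _) (Vec.[]=⇒lookup i∈s) ⟩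
    suc (occurrences i (labelsOfList cs))                     ∎))
  where
  open ≡-Reasoning
  indicator-suc : ∀ {b n} → indicator b ≡ suc n → b ≡ inside
  indicator-suc {inside} _ = refl

length≤∣S∣ : ∀ {m} {S : Subset m} f → IncMultilabelledForest S f → List.length f ℕ.≤ ∣ S ∣
length≤∣S∣ []      _  = ℕ.z≤n
length≤∣S∣ {S = S} (t ∷ f) mf
  with (L , R) , split , mt , mf′ ← Equivalence.to (incMultilabelledForest-∷⇔ {S = S} t f) mf = begin
    suc (List.length f)   ≤⟨ ℕ.+-mono-≤ (nonempty⇒0<∣p∣ (incMultilabelled⇒nonempty {S = L} mt)) (length≤∣S∣ {S = R} f mf′) ⟩
    ∣ L ∣ ℕ.+ ∣ R ∣        ≡⟨ isSplit⇒∣L∣+∣R∣≡∣S∣ {S = S} {L} {R} split ⟩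
    ∣ S ∣                 ∎
  where open ℕ.≤-Reasoning

-- Decomposition by the least label

isPartitionOf-addLeastLabel⇔ : ∀ {m} b {S s : Subset m} cs →
  IsPartitionOf (b ∷ S) (labelsOf (addLeastLabel b (node s cs))) ⇔
  (Nonempty (b ∷ s) × All Nonempty (labelsOfList cs) × CoversOnce S (s ∷ labelsOfList cs))
isPartitionOf-addLeastLabel⇔ b cs rewrite labelsOfList-mapLabelsForest (outside ∷_) cs = mk⇔
  (λ { (ne-s ∷ ne-cs , covers) → ne-s , All.map nonempty-unshift (All.map⁻ ne-cs) ,
                                   Equivalence.to (coversOnce-shift⇔ b (labelsOfList cs)) covers })
  (λ (ne-s , ne-cs , covers) → ne-s ∷ All.map⁺ (All.map nonempty-shift ne-cs) ,
                               Equivalence.from (coversOnce-shift⇔ b (labelsOfList cs)) covers)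
  where
  nonempty-shift : ∀ {m} {s : Subset m} → Nonempty s → Nonempty (outside ∷ s)
  nonempty-shift (i , i∈s) = suc i , there i∈s
  nonempty-unshift : ∀ {m} {s : Subset m} → Nonempty (outside ∷ s) → Nonempty s
  nonempty-unshift (suc i , there i∈s) = i , i∈s

incMultilabelled⇒addLeastLabel : ∀ {m} {b} {S : Subset m} {t} → IncMultilabelled (b ∷ S) t →
                                 ∃[ u ] addLeastLabel b u ≡ t
incMultilabelled⇒addLeastLabel {b = b} {t = node s cs} ((ne-s ∷ ne-cs , covers) , increasing) =
  removeLeastLabel (node s cs) , addLeastLabel-removeLeastLabel b cs (indicator-injective head-indicator) 0∉cs
  where
  0∉cs : All (zero ∉_) (labelsOfList cs)
  0∉cs = increasing⇒0∉children ne-s increasing ne-cs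
  head-indicator : indicator (lookup s zero) ≡ indicator b
  head-indicator = begin
    indicator (lookup s zero)                                        ≡⟨ ℕ.+-identityʳ _ ⟨
    indicator (lookup s zero) ℕ.+ 0                                  ≡⟨ cong (_ ℕ.+_) (occurrences-∉ (labelsOfList cs) 0∉cs) ⟨
    indicator (lookup s zero) ℕ.+ occurrences zero (labelsOfList cs) ≡⟨ occurrences-∷ zero s (labelsOfList cs) ⟨
    occurrences zero (s ∷ labelsOfList cs)                           ≡⟨ covers zero ⟩
    indicator b                                                      ∎
    where open ≡-Reasoning

incMultilabelled-addLeastLabel⇔ : ∀ {m} b {S : Subset m} s cs →
  IncMultilabelled (b ∷ S) (addLeastLabel b (node s cs)) ⇔
  (Nonempty (b ∷ s) × All Nonempty (labelsOfList cs) × CoversOnce S (s ∷ labelsOfList cs) × Increasing (node s cs))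
incMultilabelled-addLeastLabel⇔ b s cs = mk⇔
  (λ (partition , increasing) →
     let ne-s , ne-cs , covers = Equivalence.to (isPartitionOf-addLeastLabel⇔ b cs) partition
     in ne-s , ne-cs , covers , increasing-addLeastLabel⁻ b (node s cs) increasing)
  (λ (ne-s , ne-cs , covers , increasing) →
     Equivalence.from (isPartitionOf-addLeastLabel⇔ b cs) (ne-s , ne-cs , covers) ,
     increasing-addLeastLabel⁺ b (node s cs) increasing)

incMultilabelled-addLeastLabel⁺ : ∀ {m} b {S : Subset m} t → IncMultilabelled S t →
                                  IncMultilabelled (b ∷ S) (addLeastLabel b t)
incMultilabelled-addLeastLabel⁺ b (node s cs) ((ne-s ∷ ne-cs , covers) , increasing) =
  Equivalence.from (incMultilabelled-addLeastLabel⇔ b s cs) (nonempty-∷ ne-s , ne-cs , covers , increasing)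
  where
  nonempty-∷ : ∀ {m} {s : Subset m} → Nonempty s → Nonempty (b ∷ s)
  nonempty-∷ (i , i∈s) = suc i , there i∈s

children-increasing : ∀ {m} {s : Subset m} {cs} → Increasing (node s cs) → All Increasing cs
children-increasing (inc _ increasing) = increasing

incMultilabelled-plant⇔ : ∀ {m} {S : Subset m} f → IncMultilabelled (inside ∷ S) (plant f) ⇔ IncMultilabelledForest S f
incMultilabelled-plant⇔ {S = S} f = mk⇔
  (λ m → let _ , ne-f , covers , increasing = Equivalence.to (incMultilabelled-addLeastLabel⇔ inside {S} ⊥ f) m
         in (ne-f , Equivalence.to (coversOnce-⊥∷⇔ {S = S} (labelsOfList f)) covers) , children-increasing increasing)
  (λ ((ne-f , covers) , increasing) → Equivalence.from (incMultilabelled-addLeastLabel⇔ inside {S} ⊥ f)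
     ((zero , here) , ne-f , Equivalence.from (coversOnce-⊥∷⇔ {S = S} (labelsOfList f)) covers ,
      inc (All.universal (λ _ → ⊥≺) f) increasing))

incMultilabelled-outside⇔ : ∀ {m} {S : Subset m} t →
                            IncMultilabelled (outside ∷ S) t ⇔ Image (addLeastLabel outside) (IncMultilabelled S) t
incMultilabelled-outside⇔ {S = S} t = mk⇔ to from
  where
  to : ∀ {t} → IncMultilabelled (outside ∷ S) t → Image (addLeastLabel outside) (IncMultilabelled S) t
  to mt with incMultilabelled⇒addLeastLabel mt
  ... | node s cs , refl with Equivalence.to (incMultilabelled-addLeastLabel⇔ outside s cs) mt
  ... | (suc i , there i∈s) , ne-cs , covers , increasing =
    node s cs , ((((i , i∈s) ∷ ne-cs) , covers) , increasing) , refl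
  from : ∀ {t} → Image (addLeastLabel outside) (IncMultilabelled S) t → IncMultilabelled (outside ∷ S) t
  from (u , mu , refl) = incMultilabelled-addLeastLabel⁺ outside u mu

ExtendedOrPlanted : ∀ {m} → Subset m → LTree (suc m) → Set
ExtendedOrPlanted S = Image (addLeastLabel inside) (IncMultilabelled S) ∪ Image plant (IncMultilabelledForest S)

incMultilabelled-inside⇔ : ∀ {m} {S : Subset m} t → IncMultilabelled (inside ∷ S) t ⇔ ExtendedOrPlanted S t
incMultilabelled-inside⇔ {S = S} t = mk⇔ to from
  where
  to : ∀ {t} → IncMultilabelled (inside ∷ S) t → ExtendedOrPlanted S t
  to mt with node s cs , refl ← incMultilabelled⇒addLeastLabel mt = root-nonempty-or-empty s cs mt
    where
    root-nonempty-or-empty : ∀ s cs → IncMultilabelled (inside ∷ S) (addLeastLabel inside (node s cs)) →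
                             ExtendedOrPlanted S (addLeastLabel inside (node s cs))
    root-nonempty-or-empty s cs mt with Subset.nonempty? s
    ... | yes ne-s =
      let _ , ne-cs , covers , increasing = Equivalence.to (incMultilabelled-addLeastLabel⇔ inside s cs) mt
      in inj₁ (node s cs , (((ne-s ∷ ne-cs) , covers) , increasing) , refl)
    ... | no empty with refl ← Subset.Empty-unique empty =
      inj₂ (cs , Equivalence.to (incMultilabelled-plant⇔ cs) mt , refl)
  from : ∀ {t} → ExtendedOrPlanted S t → IncMultilabelled (inside ∷ S) t
  from (inj₁ (u , mu , refl)) = incMultilabelled-addLeastLabel⁺ inside u mu
  from (inj₂ (f , mf , refl)) = Equivalence.from (incMultilabelled-plant⇔ f) mf

-- Enumerating trees and forests

forests : ∀ {m} → (Subset m → List (LTree m)) → ℕ → Subset m → List (List (LTree m))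
forests trees zero    S = if does (Subset.nonempty? S) then [] else List.[ [] ]
forests trees (suc k) S =
  concatMap (λ (L , R) → List.cartesianProductWith _∷_ (trees L) (forests trees k R)) (splits S)

forests-enumerates : ∀ {m} {trees : Subset m → List (LTree m)} → (∀ L → Enumerates (IncMultilabelled L) (trees L)) →
                     ∀ k S → Enumerates (λ f → IncMultilabelledForest S f × List.length f ≡ k) (forests trees k S)
forests-enumerates trees-enum zero S with Subset.nonempty? S
... | yes ne-S = enumerates-[] λ { [] (((_ , covers) , _) , _) → Equivalence.to (coversOnce-[]⇔ {S = S}) covers ne-S }
... | no ¬ne-S = enumerates-⇔ (λ f → mk⇔ (λ { refl → (([] , covers-[]) , []) , refl }) (empty f)) (enumerates-[-] [])
  where
  covers-[] : CoversOnce S []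
  covers-[] = Equivalence.from (coversOnce-[]⇔ {S = S}) ¬ne-S
  empty : ∀ f → IncMultilabelledForest S f × List.length f ≡ 0 → f ≡ []
  empty [] _ = refl
forests-enumerates {m} trees-enum (suc k) S = enumerates-⇔ decompose
  (enumerates-concatMap split-functional (splits-enumerates S)
    (λ (L , R) → enumerates-cartesianProductWith _∷_ List.∷-injective
                   (trees-enum L) (forests-enumerates trees-enum k R)))
  where
  Cons : Subset m × Subset m → List (LTree m) → Set
  Cons (L , R) f = ∃₂ λ t f′ → IncMultilabelled L t × (IncMultilabelledForest R f′ × List.length f′ ≡ k) × t ∷ f′ ≡ f
  split-functional : ∀ {p p′ f} → Cons p f → Cons p′ f → p ≡ p′
  split-functional (t , f′ , ((_ , covers-t) , _) , (((_ , covers-f) , _) , _) , refl)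
                   (_ , _  , ((_ , covers-t′) , _) , (((_ , covers-f′) , _) , _) , refl) =
    cong₂ _,_ (coversOnce-functional {ls = labelsOf t} covers-t covers-t′)
              (coversOnce-functional {ls = labelsOfList f′} covers-f covers-f′)
  decompose : ∀ f → (∃[ p ] IsSplit S p × Cons p f) ⇔ (IncMultilabelledForest S f × List.length f ≡ suc k)
  decompose f = mk⇔ to (from f)
    where
    to : ∀ {f} → ∃[ p ] IsSplit S p × Cons p f → IncMultilabelledForest S f × List.length f ≡ suc k
    to (p , split , t , f′ , mt , (mf′ , length≡k) , refl) =
      Equivalence.from (incMultilabelledForest-∷⇔ {S = S} t f′) (p , split , mt , mf′) , cong suc length≡k
    from : ∀ f → IncMultilabelledForest S f × List.length f ≡ suc k → ∃[ p ] IsSplit S p × Cons p f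
    from (t ∷ f′) (mf , length≡1+k)
      with p , split , mt , mf′ ← Equivalence.to (incMultilabelledForest-∷⇔ {S = S} t f′) mf =
      p , split , t , f′ , mt , (mf′ , ℕ.suc-injective length≡1+k) , refl

upTo-enumerates : ∀ n → Enumerates (ℕ._< n) (upTo n)
upTo-enumerates n = Unique.upTo⁺ n , λ k → mk⇔ ∈-upTo⁻ ∈-upTo⁺

-- A forest on S has at most ∣ S ∣ trees (length≤∣S∣), so planting forests of k ≤ ∣ S ∣ trees suffices.
trees : (m : ℕ) → Subset m → List (LTree m)
trees zero    _             = []
trees (suc m) (outside ∷ S) = map (addLeastLabel outside) (trees m S)
trees (suc m) (inside ∷ S)  = map (addLeastLabel inside) (trees m S) ++
                              concatMap (λ k → map plant (forests (trees m) k S)) (upTo (suc ∣ S ∣))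

trees-enumerates : ∀ m (S : Subset m) → Enumerates (IncMultilabelled S) (trees m S)
trees-enumerates zero    S             = enumerates-[] λ { (node [] _) ((((() , _) ∷ _) , _) , _) }
trees-enumerates (suc m) (outside ∷ S) = enumerates-⇔ (λ t → ⇔-sym (incMultilabelled-outside⇔ t))
  (enumerates-map (addLeastLabel outside) (addLeastLabel-injective outside) (trees-enumerates m S))
trees-enumerates (suc m) (inside ∷ S)  =
  enumerates-⇔ (λ t → ⇔-trans (forget-length t) (⇔-sym (incMultilabelled-inside⇔ t))) (enumerates-++ disjoint
    (enumerates-map (addLeastLabel inside) (addLeastLabel-injective inside) (trees-enumerates m S))
    (enumerates-concatMap length-functional (upTo-enumerates (suc ∣ S ∣))
      (λ k → enumerates-map plant plant-injective (forests-enumerates (trees-enumerates m) k S))))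
  where
  PlantedWithLength : ℕ → LTree (suc m) → Set
  PlantedWithLength k = Image plant (λ f → IncMultilabelledForest S f × List.length f ≡ k)
  length-functional : ∀ {k k′ t} → PlantedWithLength k t → PlantedWithLength k′ t → k ≡ k′
  length-functional (f , (_ , refl) , refl) (f′ , (_ , refl) , eq) = cong List.length (plant-injective (sym eq))
  Planted : LTree (suc m) → Set
  Planted t = ∃[ k ] k ℕ.< suc ∣ S ∣ × PlantedWithLength k t
  disjoint : ∀ {t} → Image (addLeastLabel inside) (IncMultilabelled S) t → ¬ Planted t
  disjoint (node s cs , ((((i , i∈s) ∷ _) , _) , _) , refl) (_ , _ , _ , _ , eq) =
    Subset.∉⊥ (≡.subst (i ∈_) (Vec.∷-injectiveʳ (cong root (sym eq))) i∈s)
  forget-length : ∀ t → (Image (addLeastLabel inside) (IncMultilabelled S) ∪ Planted) t ⇔ ExtendedOrPlanted S t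
  forget-length t = mk⇔
    (Sum.map₂ λ (_ , _ , f , (mf , _) , eq) → f , mf , eq)
    (Sum.map₂ λ (f , mf , eq) → List.length f , ℕ.s≤s (length≤∣S∣ {S = S} f mf) , f , (mf , refl) , eq)

-- Weights

module TreeWeights (φ : ℕ → ℚ) where

  treeWeightOn : ∀ {m} → Subset m → ℚ
  treeWeightOn {m} S = sumℚ (map (weight φ) (trees m S))

  forestWeightOn : ∀ {m} → ℕ → Subset m → ℚ
  forestWeightOn {m} k S = sumℚ (map (weightList φ) (forests (trees m) k S))

  treeWeightOn-outside : ∀ {m} (S : Subset m) → treeWeightOn (outside ∷ S) ≡ treeWeightOn S
  treeWeightOn-outside {m} S = trans (sumℚ-map-∘ (weight φ) (addLeastLabel outside) (trees m S))
                                     (sumℚ-map-cong (trees m S) (weight-addLeastLabel φ outside))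

  treeWeightOn-inside : ∀ {m} (S : Subset m) →
                        treeWeightOn (inside ∷ S) ≡ treeWeightOn S + (∑[ k < suc ∣ S ∣ ] φ k * forestWeightOn k S)
  treeWeightOn-inside {m} S = begin
    treeWeightOn (inside ∷ S)
      ≡⟨ sumℚ-map-++ (weight φ) (map (addLeastLabel inside) (trees m S)) _ ⟩
    sumℚ (map (weight φ) (map (addLeastLabel inside) (trees m S))) + sumℚ (map (weight φ) planted)
      ≡⟨ cong₂ _+_ (trans (sumℚ-map-∘ (weight φ) (addLeastLabel inside) (trees m S))
                          (sumℚ-map-cong (trees m S) (weight-addLeastLabel φ inside)))
                   (sumℚ-map-concatMap (weight φ) (λ k → map plant (forests (trees m) k S)) (upTo (suc ∣ S ∣))) ⟩
    treeWeightOn S + (∑[ k < suc ∣ S ∣ ] sumℚ (map (weight φ) (map plant (forests (trees m) k S))))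
      ≡⟨ cong (treeWeightOn S +_) (sumℚ-map-cong (upTo (suc ∣ S ∣)) planted-weight) ⟩
    treeWeightOn S + (∑[ k < suc ∣ S ∣ ] φ k * forestWeightOn k S) ∎
    where
    open ≡-Reasoning
    planted : List (LTree (suc m))
    planted = concatMap (λ k → map plant (forests (trees m) k S)) (upTo (suc ∣ S ∣))
    planted-weight : ∀ k → sumℚ (map (weight φ) (map plant (forests (trees m) k S))) ≡ φ k * forestWeightOn k S
    planted-weight k = begin
      sumℚ (map (weight φ) (map plant (forests (trees m) k S)))
        ≡⟨ sumℚ-map-∘ (weight φ) plant (forests (trees m) k S) ⟩
      sumℚ (map (weight φ ∘ plant) (forests (trees m) k S))
        ≡⟨ sumℚ-map-cong-∈ (forests (trees m) k S) (λ {f} f∈ → trans (weight-addLeastLabel φ inside (node ⊥ f))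
              (cong (λ n → φ n * weightList φ f) (length≡k f∈))) ⟩
      sumℚ (map (λ f → φ k * weightList φ f) (forests (trees m) k S))
        ≡⟨ *-distribˡ-sumℚ (φ k) (weightList φ) (forests (trees m) k S) ⟨
      φ k * forestWeightOn k S ∎
      where
      length≡k : ∀ {f} → f ∈ₗ forests (trees m) k S → List.length f ≡ k
      length≡k {f} f∈ = proj₂ (Equivalence.to (proj₂ (forests-enumerates (trees-enumerates m) k S) f) f∈)

  forestWeightOn-zero : ∀ {m} (S : Subset m) → forestWeightOn 0 S ≡ one ∣ S ∣
  forestWeightOn-zero S with Subset.nonempty? S
  ... | yes ne-S with ∣ S ∣ | nonempty⇒0<∣p∣ ne-S
  ...   | suc _ | _ = refl
  forestWeightOn-zero S | no ¬ne-S rewrite Subset.Empty-unique ¬ne-S | Subset.∣⊥∣≡0 (Vec.length S) =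
    ℚ.+-identityʳ 1ℚ

  forestWeightOn-suc : ∀ {m} k (S : Subset m) →
                       forestWeightOn (suc k) S ≡ sumℚ (map (λ (L , R) → treeWeightOn L * forestWeightOn k R) (splits S))
  forestWeightOn-suc {m} k S = trans (sumℚ-map-concatMap (weightList φ) trees×forests (splits S))
    (sumℚ-map-cong (splits S) (λ (L , R) →
      sumℚ-map-cartesianProductWith _∷_ (λ _ _ → refl) (trees m L) (forests (trees m) k R)))
    where
    trees×forests : Subset m × Subset m → List (List (LTree m))
    trees×forests (L , R) = List.cartesianProductWith _∷_ (trees m L) (forests (trees m) k R)

  treeWeight : ℕ → ℚ
  treeWeight n = treeWeightOn (⊤ {n})

  forestWeight : ℕ → ℕ → ℚ
  forestWeight zero    = one
  forestWeight (suc k) = binomialConvolution treeWeight (forestWeight k)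

  DependsOnlyOnSize : ℕ → Set
  DependsOnlyOnSize m = ∀ (S : Subset m) → treeWeightOn S ≡ treeWeight ∣ S ∣

  forestWeightOn≡forestWeight : ∀ {m} → DependsOnlyOnSize m → ∀ k (S : Subset m) →
                                forestWeightOn k S ≡ forestWeight k ∣ S ∣
  forestWeightOn≡forestWeight size-only zero    S = forestWeightOn-zero S
  forestWeightOn≡forestWeight size-only (suc k) S = begin
    forestWeightOn (suc k) S
      ≡⟨ forestWeightOn-suc k S ⟩
    sumℚ (map (λ (L , R) → treeWeightOn L * forestWeightOn k R) (splits S))
      ≡⟨ sumℚ-map-cong (splits S) (λ (L , R) → cong₂ _*_ (size-only L) (forestWeightOn≡forestWeight size-only k R)) ⟩
    sumℚ (map (λ (L , R) → treeWeight ∣ L ∣ * forestWeight k ∣ R ∣) (splits S))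
      ≡⟨ sumℚ-splits treeWeight (forestWeight k) S ⟩
    forestWeight (suc k) ∣ S ∣ ∎
    where open ≡-Reasoning

  treeWeight-suc : ∀ n → DependsOnlyOnSize n →
                   treeWeight (suc n) ≡ treeWeight n + (∑[ k < suc n ] φ k * forestWeight k n)
  treeWeight-suc n size-only = begin
    treeWeightOn (inside ∷ ⊤ {n})
      ≡⟨ treeWeightOn-inside (⊤ {n}) ⟩
    treeWeight n + (∑[ k < suc ∣ ⊤ {n} ∣ ] φ k * forestWeightOn k ⊤)
      ≡⟨ cong (treeWeight n +_) (sumUpTo-cong (suc ∣ ⊤ {n} ∣)
           (λ {k} _ → cong (φ k *_) (forestWeightOn≡forestWeight size-only k ⊤))) ⟩
    treeWeight n + (∑[ k < suc ∣ ⊤ {n} ∣ ] φ k * forestWeight k ∣ ⊤ {n} ∣)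
      ≡⟨ cong (λ n′ → treeWeight n + (∑[ k < suc n′ ] φ k * forestWeight k n′)) (Subset.∣⊤∣≡n n) ⟩
    treeWeight n + (∑[ k < suc n ] φ k * forestWeight k n) ∎
    where open ≡-Reasoning

  dependsOnlyOnSize : ∀ m → DependsOnlyOnSize m
  dependsOnlyOnSize = <-rec DependsOnlyOnSize step
    where
    step : ∀ m → (∀ {n} → n ℕ.< m → DependsOnlyOnSize n) → DependsOnlyOnSize m
    step zero    _  []            = refl
    step (suc m) ih (outside ∷ S) = trans (treeWeightOn-outside S) (ih (ℕ.n<1+n m) S)
    step (suc m) ih (inside ∷ S)  = begin
      treeWeightOn (inside ∷ S)
        ≡⟨ treeWeightOn-inside S ⟩
      treeWeightOn S + (∑[ k < suc ∣ S ∣ ] φ k * forestWeightOn k S)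
        ≡⟨ cong₂ _+_ (ih (ℕ.n<1+n m) S)
                     (sumUpTo-cong (suc ∣ S ∣)
                       (λ {k} _ → cong (φ k *_) (forestWeightOn≡forestWeight (ih (ℕ.n<1+n m)) k S))) ⟩
      treeWeight ∣ S ∣ + (∑[ k < suc ∣ S ∣ ] φ k * forestWeight k ∣ S ∣)
        ≡⟨ treeWeight-suc ∣ S ∣ (ih (ℕ.s≤s (Subset.∣p∣≤n S))) ⟨
      treeWeight (suc ∣ S ∣) ∎
      where open ≡-Reasoning

  treeWeight-isEGF : IsEGF treeWeight (egf treeWeight)
  treeWeight-isEGF zero    = sym (ℚ.*-zeroˡ 1ℚ)
  treeWeight-isEGF (suc n) = refl

  ^ps-isEGF : ∀ {T} → IsEGF treeWeight T → ∀ j → IsEGF (forestWeight j) (T ^ps j)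
  ^ps-isEGF T≐ zero    zero    = sym (ℚ.*-identityʳ 1ℚ)
  ^ps-isEGF T≐ zero    (suc n) = sym (ℚ.*-zeroˡ (1/ suc n !))
  ^ps-isEGF T≐ (suc j)         = ⊛-isEGF {F = treeWeight} {G = forestWeight j} T≐ (^ps-isEGF T≐ j)

  compose-isEGF : ∀ {T} → IsEGF treeWeight T → ∀ n →
                  compose φ T n ≡ (∑[ k < suc n ] φ k * forestWeight k n) * 1/ n !
  compose-isEGF {T} T≐ n = begin
    ∑[ j < suc n ] φ j * (T ^ps j) n
      ≡⟨ sumUpTo-cong (suc n) (λ {j} _ → trans (cong (φ j *_) (^ps-isEGF T≐ j n)) (sym (ℚ.*-assoc (φ j) _ _))) ⟩
    ∑[ j < suc n ] φ j * forestWeight j n * 1/ n !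
      ≡⟨ *-distribʳ-sumℚ (1/ n !) (λ k → φ k * forestWeight k n) (upTo (suc n)) ⟨
    (∑[ k < suc n ] φ k * forestWeight k n) * 1/ n ! ∎
    where open ≡-Reasoning

  treeWeight-ode : ∀ {T} → IsEGF treeWeight T → ∀ n → deriv T n ≡ (compose φ T ⊕ T) n
  treeWeight-ode {T} T≐ n = begin
    fromℕ (suc n) * T (suc n)
      ≡⟨ cong (fromℕ (suc n) *_) (T≐ (suc n)) ⟩
    fromℕ (suc n) * (treeWeight (suc n) * 1/ suc n !)
      ≡⟨ solve 3 (λ c t f → c :* (t :* f) := t :* (c :* f)) refl
                 (fromℕ (suc n)) (treeWeight (suc n)) (1/ suc n !) ⟩
    treeWeight (suc n) * (fromℕ (suc n) * 1/ suc n !)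
      ≡⟨ cong₂ _*_ (treeWeight-suc n (dependsOnlyOnSize n)) ([1+n]*1/[1+n]!≡1/n! n) ⟩
    (treeWeight n + Σφ) * 1/ n !
      ≡⟨ solve 3 (λ t s f → (t :+ s) :* f := s :* f :+ t :* f) refl (treeWeight n) Σφ (1/ n !) ⟩
    Σφ * 1/ n ! + treeWeight n * 1/ n !
      ≡⟨ cong₂ _+_ (compose-isEGF T≐ n) (T≐ n) ⟨
    compose φ T n + T n ∎
    where
    open ≡-Reasoning
    open +-*-Solver
    Σφ : ℚ
    Σφ = ∑[ k < suc n ] φ k * forestWeight k n

enumeration : (m : ℕ) → Enumeration m
enumeration m = trees m ⊤ , enumerates-⇔ (λ t → ⇔-sym (isFreeIncMultilabelled⇔ t)) (trees-enumerates m ⊤)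

proposition7p1 : (φ : ℕ → ℚ) → (∀ j → 0ℚ ≤ φ j) → 0ℚ < φ 0 →
    ((m : ℕ) → Enumeration m) ×
    ((E : (m : ℕ) → Enumeration m) →
      let T = egf (λ m → totalWeight φ (E m)) in
      ((n : ℕ) → deriv T n ≡ (compose φ T ⊕ T) n) × T 0 ≡ 0ℚ)
proposition7p1 φ _ _ = enumeration , λ E → treeWeight-ode (isEGF E) , refl
  where
  open TreeWeights φ
  isEGF : ∀ E → IsEGF treeWeight (egf (λ m → totalWeight φ (E m)))
  isEGF E zero    = treeWeight-isEGF zero
  isEGF E (suc m) =
    cong (_* 1/ suc m !) (sumℚ-map-enumerates (weight φ) (proj₂ (E (suc m))) (proj₂ (enumeration (suc m))))
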